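{- The variety of upper semilattice-ordered pocrigs is arithmetical, i.e. congruence distributive and congruence permutable.
   Context: An upper semilattice-ordered pocrig is an algebra $(A,\vee,\cdot,\to,1)$ where $(A,\vee)$ is a join-semilattice with order $\le$, $\cdot$ is commutative and isotone ($x\le y$ implies $xz\le yz$), $1$ is a neutral element for $\cdot$ and the greatest element of $A$, and $x\le y\to z$ iff $xy\le z$ for all $x,y,z$. (This class is equationally definable.) -}

module Defs where

open import Level using (Level; _⊔_; suc)
open import Relation.Binary.PropositionalEquality using (_≡_)
open import Relation.Binary.Core using (Rel; _⇒_)
open import Relation.Binary.Structures using (IsEquivalence)
open import Data.Product using (_×_; Σ; ∃; _,_)
open import Data.Sum using (_⊎_)

-- An upper semilattice-ordered pocrig (A, ∨, ·, →, 1), exactly as in the paper's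
-- definition: (A, ∨) is a join-semilattice with induced order ≤ (x ≤ y iff x ∨ y = y),
-- · is commutative and isotone, 1 is neutral for · and the greatest element,
-- and x ≤ y → z iff x · y ≤ z.  (No associativity of · is assumed.)
record USPocrig (a : Level) : Set (suc a) where
  infixl 6 _∨_
  infixl 7 _·_
  infixr 5 _⇒'_
  infix 4 _≤_
  field
    Carrier : Set a
    _∨_     : Carrier → Carrier → Carrier
    _·_     : Carrier → Carrier → Carrier
    _⇒'_    : Carrier → Carrier → Carrier
    one     : Carrier

  _≤_ : Carrier → Carrier → Set a
  x ≤ y = x ∨ y ≡ y

  field
    ∨-assoc   : ∀ x y z → (x ∨ y) ∨ z ≡ x ∨ (y ∨ z)
    ∨-comm    : ∀ x y → x ∨ y ≡ y ∨ x
    ∨-idem    : ∀ x → x ∨ x ≡ x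
    ·-comm    : ∀ x y → x · y ≡ y · x
    ·-isotone : ∀ x y z → x ≤ y → x · z ≤ y · z
    ·-identity : ∀ x → one · x ≡ x
    one-top   : ∀ x → x ≤ one
    residuation₁ : ∀ x y z → x ≤ y ⇒' z → x · y ≤ z
    residuation₂ : ∀ x y z → x · y ≤ z → x ≤ y ⇒' z

-- Congruences of an upper semilattice-ordered pocrig: equivalence relations
-- compatible with all basic operations (the constant 1 imposes no condition).
record IsCongruence {a ℓ : Level} (A : USPocrig a) (θ : Rel (USPocrig.Carrier A) ℓ)
       : Set (a ⊔ ℓ) where
  open USPocrig A
  field
    isEquivalence : IsEquivalence θ
    ∨-compat : ∀ {x x' y y'} → θ x x' → θ y y' → θ (x ∨ y) (x' ∨ y')
    ·-compat : ∀ {x x' y y'} → θ x x' → θ y y' → θ (x · y) (x' · y')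
    ⇒-compat : ∀ {x x' y y'} → θ x x' → θ y y' → θ (x ⇒' y) (x' ⇒' y')

_∘ᴿ_ : {a ℓ₁ ℓ₂ : Level} {C : Set a} → Rel C ℓ₁ → Rel C ℓ₂ → Rel C (a ⊔ ℓ₁ ⊔ ℓ₂)
(θ ∘ᴿ φ) x y = ∃ λ z → θ x z × φ z y

_∧ᶜ_ : {a ℓ₁ ℓ₂ : Level} {C : Set a} → Rel C ℓ₁ → Rel C ℓ₂ → Rel C (ℓ₁ ⊔ ℓ₂)
(θ ∧ᶜ φ) x y = θ x y × φ x y

data _∨ᶜ_ {a ℓ₁ ℓ₂ : Level} {C : Set a} (θ : Rel C ℓ₁) (φ : Rel C ℓ₂)
       : Rel C (a ⊔ ℓ₁ ⊔ ℓ₂) where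
  step  : ∀ {x y} → θ x y ⊎ φ x y → (θ ∨ᶜ φ) x y
  trans : ∀ {x y z} → (θ ∨ᶜ φ) x y → (θ ∨ᶜ φ) y z → (θ ∨ᶜ φ) x z

-- Congruence permutability of an algebra: θ ∘ φ = φ ∘ θ for all congruences
-- (stated as θ ∘ φ ⊆ φ ∘ θ for all θ, φ, which gives equality by symmetry).
CongruencePermutable : {a : Level} → (ℓ : Level) → USPocrig a → Set (a ⊔ suc ℓ)
CongruencePermutable ℓ A =
  ∀ (θ φ : Rel (USPocrig.Carrier A) ℓ) → IsCongruence A θ → IsCongruence A φ →
    (θ ∘ᴿ φ) ⇒ (φ ∘ᴿ θ)

CongruenceDistributive : {a : Level} → (ℓ : Level) → USPocrig a → Set (a ⊔ suc ℓ)
CongruenceDistributive ℓ A =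
  ∀ (θ φ ψ : Rel (USPocrig.Carrier A) ℓ) →
    IsCongruence A θ → IsCongruence A φ → IsCongruence A ψ →
    ((θ ∧ᶜ (φ ∨ᶜ ψ)) ⇒ ((θ ∧ᶜ φ) ∨ᶜ (θ ∧ᶜ ψ))) ×
    (((θ ∧ᶜ φ) ∨ᶜ (θ ∧ᶜ ψ)) ⇒ (θ ∧ᶜ (φ ∨ᶜ ψ)))

Arithmetical : (a ℓ : Level) → Set (suc a ⊔ suc ℓ)
Arithmetical a ℓ = (A : USPocrig a) → CongruenceDistributive ℓ A × CongruencePermutable ℓ A

-- An algebra is
-- congruence permutable as soon as it has a Mal'cev term p
-- (p x x z = z, p x z z = x), and congruence distributive as soon as it has a
-- majority term m (m x y x = m x x y = m y x x = x; we use the equivalent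
-- form m x y x = x, m x x z = x, m x y y = y).
--
-- For pocrigs the residuation law yields modus ponens x · (x → y) ≤ y and
-- x ≤ y ⇒ x → y = 1, from which
--     p x y z = x · (y → z) ∨ z · (y → x)           is a Mal'cev term,
--     m x y z = x · (x → y) ∨ z · (z → (x ∨ y))     is a majority term.
-- Every congruence preserves these terms, so the general facts apply.
module Submission where

open import Defs
open import Level using (Level; _⊔_)
open import Relation.Binary.PropositionalEquality
  using (_≡_; sym; cong; subst; subst₂; module ≡-Reasoning)
  renaming (trans to ≡-trans)
open import Relation.Binary.Core using (Rel; _⇒_)
open import Relation.Binary.Definitions using (Reflexive; Symmetric; Transitive)
open import Relation.Binary.Structures using (IsEquivalence)
open import Data.Product using (_,_)
open import Data.Sum using (inj₁; inj₂)

Preserves₃ : {c ℓ : Level} {C : Set c} → (C → C → C → C) → Rel C ℓ → Set (c ⊔ ℓ)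
Preserves₃ t θ = ∀ {x x' y y' z z'} → θ x x' → θ y y' → θ z z' → θ (t x y z) (t x' y' z')

record IsMalcev {c : Level} {C : Set c} (p : C → C → C → C) : Set c where
  field
    p-xxz : ∀ x z → p x x z ≡ z
    p-xzz : ∀ x z → p x z z ≡ x

record IsMajority {c : Level} {C : Set c} (m : C → C → C → C) : Set c where
  field
    m-xyx : ∀ x y → m x y x ≡ x
    m-xxz : ∀ x z → m x x z ≡ x
    m-xyy : ∀ x y → m x y y ≡ y

-- Mal'cev's lemma: relations preserving a Mal'cev term permute.  If x θ z φ y,
-- the element w = p x z y satisfies x φ w (as w φ p x y y = x) and
-- w θ y (as w θ p z z y = y).
malcev⇒permute :
  {c ℓ₁ ℓ₂ : Level} {C : Set c} {p : C → C → C → C} → IsMalcev p →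
  (θ : Rel C ℓ₁) (φ : Rel C ℓ₂) →
  Reflexive θ → Reflexive φ → Symmetric φ →
  Preserves₃ p θ → Preserves₃ p φ → (θ ∘ᴿ φ) ⇒ (φ ∘ᴿ θ)
malcev⇒permute {p = p} malcev θ φ θ-refl φ-refl φ-sym θ-p φ-p {x} {y} (z , xθz , zφy) =
  p x z y , x-φ-w , w-θ-y
  where
    open IsMalcev malcev
    x-φ-w : φ x (p x z y)
    x-φ-w = subst (λ t → φ t (p x z y)) (p-xzz x y) (φ-p φ-refl (φ-sym zφy) φ-refl)
    w-θ-y : θ (p x z y) y
    w-θ-y = subst (θ (p x z y)) (p-xxz z y) (θ-p xθz θ-refl θ-refl)

meet-join-subdistributive :
  {c ℓ₁ ℓ₂ ℓ₃ : Level} {C : Set c} (θ : Rel C ℓ₁) (φ : Rel C ℓ₂) (ψ : Rel C ℓ₃) →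
  Transitive θ → ((θ ∧ᶜ φ) ∨ᶜ (θ ∧ᶜ ψ)) ⇒ (θ ∧ᶜ (φ ∨ᶜ ψ))
meet-join-subdistributive θ φ ψ θ-trans (step (inj₁ (xθy , xφy))) = xθy , step (inj₁ xφy)
meet-join-subdistributive θ φ ψ θ-trans (step (inj₂ (xθy , xψy))) = xθy , step (inj₂ xψy)
meet-join-subdistributive θ φ ψ θ-trans (trans c d)
  with meet-join-subdistributive θ φ ψ θ-trans c
     | meet-join-subdistributive θ φ ψ θ-trans d
... | xθy , xφψy | yθz , yφψz = θ-trans xθy yθz , trans xφψy yφψz

-- Jónsson's argument for a majority term: if x θ y and x = u₀, …, uₙ = y is a
-- (φ ∨ ψ)-chain, then x = m x u₀ y, …, m x uₙ y = y is a chain whose steps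
-- lie in θ ∧ φ or θ ∧ ψ, because every m x uᵢ y is θ-related to m x uᵢ x = x.
majority⇒distributive :
  {c ℓ₁ ℓ₂ ℓ₃ : Level} {C : Set c} {m : C → C → C → C} → IsMajority m →
  (θ : Rel C ℓ₁) (φ : Rel C ℓ₂) (ψ : Rel C ℓ₃) →
  IsEquivalence θ → Reflexive φ → Reflexive ψ →
  Preserves₃ m θ → Preserves₃ m φ → Preserves₃ m ψ →
  (θ ∧ᶜ (φ ∨ᶜ ψ)) ⇒ ((θ ∧ᶜ φ) ∨ᶜ (θ ∧ᶜ ψ))
majority⇒distributive {m = m} majority θ φ ψ θ-equiv φ-refl ψ-refl θ-m φ-m ψ-m {x} {y} (xθy , chain) =
  subst₂ ((θ ∧ᶜ φ) ∨ᶜ (θ ∧ᶜ ψ)) (m-xxz x y) (m-xyy x y) (transport chain)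
  where
    open IsMajority majority
    module θ = IsEquivalence θ-equiv

    collapse : ∀ u → θ (m x u y) x
    collapse u = subst (θ (m x u y)) (m-xyx x u) (θ-m θ.refl θ.refl (θ.sym xθy))

    θ-middle : ∀ u v → θ (m x u y) (m x v y)
    θ-middle u v = θ.trans (collapse u) (θ.sym (collapse v))

    transport : ∀ {u v} → (φ ∨ᶜ ψ) u v → ((θ ∧ᶜ φ) ∨ᶜ (θ ∧ᶜ ψ)) (m x u y) (m x v y)
    transport {u} {v} (step (inj₁ uφv)) = step (inj₁ (θ-middle u v , φ-m φ-refl uφv φ-refl))
    transport {u} {v} (step (inj₂ uψv)) = step (inj₂ (θ-middle u v , ψ-m ψ-refl uψv ψ-refl))
    transport (trans c d) = trans (transport c) (transport d)

module PocrigTerms {a : Level} (A : USPocrig a) where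
  open USPocrig A
  open ≡-Reasoning

  ≤-refl : ∀ x → x ≤ x
  ≤-refl = ∨-idem

  ≤-antisym : ∀ {x y} → x ≤ y → y ≤ x → x ≡ y
  ≤-antisym {x} {y} x≤y y≤x = ≡-trans (sym y≤x) (≡-trans (∨-comm y x) x≤y)

  ≤⇒absorb : ∀ {x y} → x ≤ y → y ∨ x ≡ y
  ≤⇒absorb {x} {y} x≤y = ≡-trans (∨-comm y x) x≤y

  ≤-∨ʳ : ∀ x y → y ≤ x ∨ y
  ≤-∨ʳ x y = begin
    y ∨ (x ∨ y)  ≡⟨ cong (y ∨_) (∨-comm x y) ⟩
    y ∨ (y ∨ x)  ≡⟨ sym (∨-assoc y y x) ⟩
    (y ∨ y) ∨ x  ≡⟨ cong (_∨ x) (∨-idem y) ⟩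
    y ∨ x        ≡⟨ ∨-comm y x ⟩
    x ∨ y        ∎

  ≤-∨ˡ : ∀ x y → x ≤ x ∨ y
  ≤-∨ˡ x y = subst (x ≤_) (∨-comm y x) (≤-∨ʳ y x)

  ·-identityʳ : ∀ x → x · one ≡ x
  ·-identityʳ x = ≡-trans (·-comm x one) (·-identity x)

  modus-ponens : ∀ x y → x · (x ⇒' y) ≤ y
  modus-ponens x y = subst (_≤ y) (·-comm (x ⇒' y) x)
    (residuation₁ (x ⇒' y) x y (≤-refl (x ⇒' y)))

  modus-ponens-≤ : ∀ x y → x · (x ⇒' y) ≤ x
  modus-ponens-≤ x y = subst₂ _≤_ (·-comm (x ⇒' y) x) (·-identity x)
    (·-isotone (x ⇒' y) one x (one-top (x ⇒' y)))

  ≤⇒implication-one : ∀ {x y} → x ≤ y → x ⇒' y ≡ one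
  ≤⇒implication-one {x} {y} x≤y = ≤-antisym (one-top (x ⇒' y))
    (residuation₂ one x y (subst (_≤ y) (sym (·-identity x)) x≤y))

  ·-implication-≤ : ∀ z {x y} → x ≤ y → z · (x ⇒' y) ≡ z
  ·-implication-≤ z x≤y = ≡-trans (cong (z ·_) (≤⇒implication-one x≤y)) (·-identityʳ z)

  malcev : Carrier → Carrier → Carrier → Carrier
  malcev x y z = x · (y ⇒' z) ∨ z · (y ⇒' x)

  malcev-isMalcev : IsMalcev malcev
  malcev-isMalcev = record { p-xxz = p-xxz ; p-xzz = p-xzz }
    where
      p-xxz : ∀ x z → malcev x x z ≡ z
      p-xxz x z = begin
        x · (x ⇒' z) ∨ z · (x ⇒' x)  ≡⟨ cong (x · (x ⇒' z) ∨_) (·-implication-≤ z (≤-refl x)) ⟩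
        x · (x ⇒' z) ∨ z              ≡⟨ modus-ponens x z ⟩
        z                             ∎
      p-xzz : ∀ x z → malcev x z z ≡ x
      p-xzz x z = begin
        x · (z ⇒' z) ∨ z · (z ⇒' x)  ≡⟨ cong (_∨ z · (z ⇒' x)) (·-implication-≤ x (≤-refl z)) ⟩
        x ∨ z · (z ⇒' x)              ≡⟨ ≤⇒absorb (modus-ponens z x) ⟩
        x                             ∎

  majority : Carrier → Carrier → Carrier → Carrier
  majority x y z = x · (x ⇒' y) ∨ z · (z ⇒' (x ∨ y))

  majority-isMajority : IsMajority majority
  majority-isMajority = record { m-xyx = m-xyx ; m-xxz = m-xxz ; m-xyy = m-xyy }
    where
      m-xyx : ∀ x y → majority x y x ≡ x
      m-xyx x y = begin
        x · (x ⇒' y) ∨ x · (x ⇒' (x ∨ y))  ≡⟨ cong (x · (x ⇒' y) ∨_) (·-implication-≤ x (≤-∨ˡ x y)) ⟩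
        x · (x ⇒' y) ∨ x                    ≡⟨ modus-ponens-≤ x y ⟩
        x                                   ∎
      m-xxz : ∀ x z → majority x x z ≡ x
      m-xxz x z = begin
        x · (x ⇒' x) ∨ z · (z ⇒' (x ∨ x))  ≡⟨ cong (λ t → x · (x ⇒' x) ∨ z · (z ⇒' t)) (∨-idem x) ⟩
        x · (x ⇒' x) ∨ z · (z ⇒' x)        ≡⟨ cong (_∨ z · (z ⇒' x)) (·-implication-≤ x (≤-refl x)) ⟩
        x ∨ z · (z ⇒' x)                    ≡⟨ ≤⇒absorb (modus-ponens z x) ⟩
        x                                   ∎
      m-xyy : ∀ x y → majority x y y ≡ y
      m-xyy x y = begin
        x · (x ⇒' y) ∨ y · (y ⇒' (x ∨ y))  ≡⟨ cong (x · (x ⇒' y) ∨_) (·-implication-≤ y (≤-∨ʳ x y)) ⟩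
        x · (x ⇒' y) ∨ y                    ≡⟨ modus-ponens x y ⟩
        y                                   ∎

  module _ {ℓ : Level} {θ : Rel Carrier ℓ} (θ-cong : IsCongruence A θ) where
    open IsCongruence θ-cong

    malcev-preserved : Preserves₃ malcev θ
    malcev-preserved xθx' yθy' zθz' =
      ∨-compat (·-compat xθx' (⇒-compat yθy' zθz')) (·-compat zθz' (⇒-compat yθy' xθx'))

    majority-preserved : Preserves₃ majority θ
    majority-preserved xθx' yθy' zθz' =
      ∨-compat (·-compat xθx' (⇒-compat xθx' yθy'))
               (·-compat zθz' (⇒-compat zθz' (∨-compat xθx' yθy')))

theorem5p6 : ∀ (a ℓ : Level) → Arithmetical a ℓ
theorem5p6 a ℓ A = distributive , permutable
  where
    open PocrigTerms A
    open IsCongruence using (isEquivalence)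
    module Equiv = IsEquivalence

    permutable : CongruencePermutable ℓ A
    permutable θ φ θ-cong φ-cong =
      malcev⇒permute malcev-isMalcev θ φ
        (Equiv.refl (isEquivalence θ-cong))
        (Equiv.refl (isEquivalence φ-cong)) (Equiv.sym (isEquivalence φ-cong))
        (malcev-preserved θ-cong) (malcev-preserved φ-cong)

    distributive : CongruenceDistributive ℓ A
    distributive θ φ ψ θ-cong φ-cong ψ-cong =
        majority⇒distributive majority-isMajority θ φ ψ
          (isEquivalence θ-cong) (Equiv.refl (isEquivalence φ-cong)) (Equiv.refl (isEquivalence ψ-cong))
          (majority-preserved θ-cong) (majority-preserved φ-cong) (majority-preserved ψ-cong)
      , meet-join-subdistributive θ φ ψ (Equiv.trans (isEquivalence θ-cong))
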